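{- Let $D$ be a semicomplete digraph. Then $\mathrm{def}(D)=1$ if $D$ is a nontrivial even digraph with exactly one peripheral vertex, and $\mathrm{def}(D)=0$ otherwise.
   Context: All digraphs are finite, without loops or parallel arcs (a pair of opposite arcs $uv, vu$ is allowed). A digraph $D$ is semicomplete if every pair of distinct vertices is joined by at least one arc (in one or both directions). For a vertex $v$, the semi-cuts of $v$ are $\partial_D^+(v)=\{vw\in A(D)\}$ and $\partial_D^-(v)=\{uv\in A(D)\}$, with $d_D^\pm(v)=|\partial_D^\pm(v)|$ and $d_D(v)=d_D^+(v)+d_D^-(v)$. A map $\varphi:A(D)\to\{1,2\}$ satisfies condition (WO) at $v$ if there is a color $i\in\{1,2\}$ such that every nonempty semi-cut of $v$ contains an odd number of arcs of color $i$ (vacuously true if both semi-cuts are empty). The defect $\mathrm{def}(D)$ is the minimum, over all maps $\varphi:A(D)\to\{1,2\}$, of the number of vertices at which (WO) fails. A vertex $v$ is peripheral if $d_D^+(v)=0$ or $d_D^-(v)=0$. $D$ is even if $d_D(v)$ is even for every $v$; nontrivial means more than one vertex. -}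

module Defs where

open import Data.Nat using (ℕ; zero; suc; _<_; _≤_; _<?_)
open import Data.Nat.Divisibility using (_∣_; _∣?_)
open import Data.Fin using (Fin)
open import Data.Fin.Properties using (any?)
open import Data.Bool using (Bool; true; false; T)
open import Data.Bool.Properties using (T?)
open import Data.List using (List; length; filter)
open import Data.List.Base using (allFin)
open import Data.Product using (Σ; ∃; _×_; _,_)
open import Data.Sum using (_⊎_)
open import Relation.Nullary using (¬_; Dec)
open import Relation.Nullary.Decidable using (_×-dec_; _→-dec_; ¬?)
open import Relation.Binary.PropositionalEquality using (_≡_; _≢_)

Even : ℕ → Set
Even m = 2 ∣ m

Odd : ℕ → Set
Odd m = ¬ (2 ∣ m)

countFin : {n : ℕ} {P : Fin n → Set} → ((x : Fin n) → Dec (P x)) → ℕ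
countFin {n} P? = length (filter P? (allFin n))

-- A digraph on vertex set Fin n: arc relation given by a Boolean adjacency
-- (so no parallel arcs), with no loops.  Opposite arcs uv, vu are allowed.
record Digraph : Set where
  field
    n        : ℕ
    arc      : Fin n → Fin n → Bool
    loopless : (v : Fin n) → arc v v ≡ false
open Digraph public

Semicomplete : Digraph → Set
Semicomplete D = (u v : Fin (n D)) → u ≢ v → T (arc D u v) ⊎ T (arc D v u)

outdeg indeg deg : (D : Digraph) → Fin (n D) → ℕ
outdeg D v = countFin (λ w → T? (arc D v w))
indeg  D v = countFin (λ u → T? (arc D u v))
deg D v = outdeg D v Data.Nat.+ indeg D v

-- A 2-colouring of the arcs (colours Fin 2 = {1,2}); the value on non-arcs is irrelevant.
Colouring : Digraph → Set
Colouring D = Fin (n D) → Fin (n D) → Fin 2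

outcol incol : (D : Digraph) → Colouring D → Fin 2 → Fin (n D) → ℕ
outcol D φ i v = countFin (λ w → T? (arc D v w) ×-dec (φ v w Data.Fin.≟ i))
incol  D φ i v = countFin (λ u → T? (arc D u v) ×-dec (φ u v Data.Fin.≟ i))

WO : (D : Digraph) → Colouring D → Fin (n D) → Set
WO D φ v = ∃ λ (i : Fin 2) →
  (0 < outdeg D v → Odd (outcol D φ i v)) × (0 < indeg D v → Odd (incol D φ i v))

WO? : (D : Digraph) (φ : Colouring D) (v : Fin (n D)) → Dec (WO D φ v)
WO? D φ v = any? λ i →
  (0 <? outdeg D v →-dec ¬? (2 ∣? outcol D φ i v)) ×-dec
  (0 <? indeg D v →-dec ¬? (2 ∣? incol D φ i v))

failures : (D : Digraph) → Colouring D → ℕ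
failures D φ = countFin (λ v → ¬? (WO? D φ v))

IsDefect : Digraph → ℕ → Set
IsDefect D k = (Σ (Colouring D) λ φ → failures D φ ≡ k) × ((φ : Colouring D) → k ≤ failures D φ)

Peripheral : (D : Digraph) → Fin (n D) → Set
Peripheral D v = outdeg D v ≡ 0 ⊎ indeg D v ≡ 0

EvenDigraph : Digraph → Set
EvenDigraph D = (v : Fin (n D)) → Even (deg D v)

Nontrivial : Digraph → Set
Nontrivial D = 2 ≤ n D

ExactlyOnePeripheral : Digraph → Set
ExactlyOnePeripheral D = ∃ λ v → Peripheral D v × ((w : Fin (n D)) → Peripheral D w → w ≡ v)

SpecialCase : Digraph → Set
SpecialCase D = Nontrivial D × EvenDigraph D × ExactlyOnePeripheral D

-- Let o(v), i(v) ∈ 𝔽₂ be the parities of the arcs of the first colour leaving and entering v.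
-- Whether (WO) holds at v depends only on o(v), i(v) and on whether each semi-cut of v is empty,
-- of positive even size or of odd size, and it is implied by at most two linear equations among
-- o = 1, i = 1, o = i.  By the Fredholm alternative over 𝔽₂, the system of these equations in the
-- colours of the arcs is either solvable, which gives a colouring satisfying (WO) everywhere, or
-- some combination of its equations reads 0 = 1.  Such a combination yields labels α, β : V → 𝔽₂
-- with α(u) = β(w) for every arc uw and an odd number of vertices where α ≠ β; in a semicomplete
-- digraph the local constraints on the labels force one of α, β to be constantly 1 and D to be
-- even with a unique peripheral vertex p.  Conversely in that case (WO) at every vertex would give
-- o = i away from p and o ≠ i at p, contradicting Σ o = Σ i (both count the arcs of the first
-- colour).  Dropping the equations at p leaves a system with no refutation, since a refutation
-- would again need nonzero labels at p; so one failure suffices.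

module Submission where

open import Defs
open import Algebra.Bundles using (CommutativeRing)
open import Data.Bool using (Bool; true; false; not; _∧_; _xor_; if_then_else_; T; T?)
open import Data.Bool.Properties
  using (xor-∧-commutativeRing; ∧-zeroʳ; ∧-identityʳ; xor-identityʳ; xor-same; xor-assoc; xor-comm
        ; ∧-distribʳ-xor; ∧-distribˡ-xor; ∧-assoc; ∧-comm; ¬-not; not-involutive; not-distribˡ-xor)
open import Data.Fin using (Fin; zero; suc; _≟_; _↑ˡ_; _↑ʳ_; combine; remQuot)
open import Data.Fin.Properties using (any?; remQuot-combine)
open import Data.List using (List; []; _∷_; length; filter; tabulate; allFin)
open import Data.List.Properties using (filter-some; filter-none)
open import Data.List.Membership.Propositional.Properties using (∈-filter⁻)
import Data.List.Relation.Unary.All as All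
open import Data.List.Relation.Unary.All using (All; []; _∷_)
import Data.List.Relation.Unary.All.Properties as All
import Data.List.Relation.Unary.Any.Properties as Any
open import Data.List.Relation.Unary.AllPairs using ([]; _∷_)
open import Data.List.Relation.Unary.Unique.Propositional using (Unique)
import Data.List.Relation.Unary.Unique.Propositional.Properties as Unique
open import Data.Nat using (ℕ; zero; suc; _+_; _*_; _≤_; _<_; z≤n; s≤s)
open import Data.Nat.Divisibility using (divides)
open import Data.Nat.Properties using (n≢0⇒n>0; +-identityʳ; +-comm; ≤-antisym)
open import Data.Product using (∃; ∃-syntax; _×_; _,_; proj₁; proj₂; uncurry)
open import Data.Sum using (_⊎_; inj₁; inj₂)
import Data.Sum
open import Data.Unit using (⊤; tt)
open import Data.Empty using (⊥; ⊥-elim)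
open import Data.Vec.Functional as Vector using (Vector)
open import Function using (_∘_; _∘₂_; _⇔_; mk⇔; Equivalence)
open import Relation.Nullary using (¬_; Dec; does; yes; no; contradiction)
open import Relation.Nullary.Decidable using (_×-dec_; ¬?; dec-true; dec-false; decidable-stable)
open import Relation.Binary.PropositionalEquality

open CommutativeRing xor-∧-commutativeRing using (semiring)
open import Algebra.Properties.Semiring.Sum semiring
  using (sum-syntax; ∑-comm; ∑-distrib-+; *-distribˡ-sum; *-distribʳ-sum; sum-cong-≗; sum-replicate-zero)

¬T⇒≡false : ∀ {b} → ¬ T b → b ≡ false
¬T⇒≡false {false} _  = refl
¬T⇒≡false {true}  ¬t = contradiction tt ¬t

xor≡false⇒≡ : ∀ a b → a xor b ≡ false → a ≡ b
xor≡false⇒≡ false false _ = refl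
xor≡false⇒≡ true  true  _ = refl
xor≡false⇒≡ false true  ()
xor≡false⇒≡ true  false ()

xor-cancelˡ : ∀ x y → x xor (y xor x) ≡ y
xor-cancelˡ false y     = xor-identityʳ y
xor-cancelˡ true  false = refl
xor-cancelˡ true  true  = refl

xor-cancelʳ : ∀ x y → (x xor y) xor y ≡ x
xor-cancelʳ x false = trans (xor-identityʳ (x xor false)) (xor-identityʳ x)
xor-cancelʳ false true = refl
xor-cancelʳ true  true = refl

oddᵇ : ℕ → Bool
oddᵇ zero    = false
oddᵇ (suc n) = not (oddᵇ n)

oddᵇ-+ : ∀ m n → oddᵇ (m + n) ≡ oddᵇ m xor oddᵇ n
oddᵇ-+ zero    n = refl
oddᵇ-+ (suc m) n = trans (cong not (oddᵇ-+ m n)) (not-distribˡ-xor (oddᵇ m) (oddᵇ n))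

even⇒oddᵇ≡false : ∀ {n} → Even n → oddᵇ n ≡ false
even⇒oddᵇ≡false (divides q refl) = oddᵇ-*2 q
  where
  oddᵇ-*2 : ∀ q → oddᵇ (q * 2) ≡ false
  oddᵇ-*2 zero    = refl
  oddᵇ-*2 (suc q) = trans (not-involutive _) (oddᵇ-*2 q)

oddᵇ≡false⇒even : ∀ n → oddᵇ n ≡ false → Even n
oddᵇ≡false⇒even zero          _ = divides 0 refl
oddᵇ≡false⇒even (suc zero)    ()
oddᵇ≡false⇒even (suc (suc n)) e with oddᵇ≡false⇒even n (trans (sym (not-involutive _)) e)
... | divides q eq = divides (suc q) (cong (λ m → suc (suc m)) eq)

oddᵇ≡true⇔Odd : ∀ n → oddᵇ n ≡ true ⇔ Odd n
oddᵇ≡true⇔Odd n = mk⇔ (λ o ev → contradiction (trans (sym o) (even⇒oddᵇ≡false ev)) λ ())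
                      (λ odd → ¬-not λ e → odd (oddᵇ≡false⇒even n e))

module _ {n} {P : Fin n → Set} (P? : (i : Fin n) → Dec (P i)) where

  countFin-positive : ∀ i → P i → 0 < countFin P?
  countFin-positive i p = filter-some P? (Any.tabulate⁺ i p)

  countFin-none : (∀ i → ¬ P i) → countFin P? ≡ 0
  countFin-none ¬p = cong length (filter-none P? (All.tabulate⁺ ¬p))

  countFin≡0⇒¬ : countFin P? ≡ 0 → ∀ i → ¬ P i
  countFin≡0⇒¬ c≡0 i p = contradiction (subst (0 <_) c≡0 (countFin-positive i p)) λ ()

  countFin-witness : 0 < countFin P? → ∃ P
  countFin-witness pos with any? P?
  ... | yes w  = w
  ... | no ¬w  = contradiction (subst (0 <_) (countFin-none λ i p → ¬w (i , p)) pos) λ ()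

  countFin≤1 : ∀ p → (∀ i → P i → i ≡ p) → countFin P? ≤ 1
  countFin≤1 p only-p = unique-constant (Unique.filter⁺ P? (Unique.allFin⁺ n))
                                        (All.tabulate λ {i} i∈ → only-p i (proj₂ (∈-filter⁻ P? {xs = allFin n} i∈)))
    where
    unique-constant : ∀ {xs : List (Fin n)} → Unique xs → All (_≡ p) xs → length xs ≤ 1
    unique-constant []                    []                 = z≤n
    unique-constant (_ ∷ [])              (_ ∷ [])           = s≤s z≤n
    unique-constant ((x≢y ∷ _) ∷ _)       (x≡p ∷ y≡p ∷ _)    = contradiction (trans x≡p (sym y≡p)) x≢y

oddᵇ-count : ∀ {A : Set} {P : A → Set} (P? : ∀ a → Dec (P a)) {k} (f : Fin k → A) →
             oddᵇ (length (filter P? (tabulate f))) ≡ ∑[ i < k ] does (P? (f i))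
oddᵇ-count P? {zero}  f = refl
oddᵇ-count P? {suc k} f with does (P? (f zero))
... | true  = cong not (oddᵇ-count P? (f ∘ suc))
... | false = oddᵇ-count P? (f ∘ suc)

oddᵇ-countFin : ∀ {k} {P : Fin k → Set} (P? : ∀ i → Dec (P i)) → oddᵇ (countFin P?) ≡ ∑[ i < k ] does (P? i)
oddᵇ-countFin P? = oddᵇ-count P? (λ i → i)

∑-select : ∀ {k} (i : Fin k) (f : Vector Bool k) → ∑[ j < k ] (does (i ≟ j) ∧ f j) ≡ f i
∑-select {suc k} zero    f = trans (cong (f zero xor_) (sum-replicate-zero k)) (xor-identityʳ (f zero))
∑-select {suc k} (suc i) f = ∑-select i (f ∘ suc)

∑-select′ : ∀ {k} (i : Fin k) (f : Vector Bool k) → ∑[ j < k ] (does (j ≟ i) ∧ f j) ≡ f i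
∑-select′ {suc k} zero    f = trans (cong (f zero xor_) (sum-replicate-zero k)) (xor-identityʳ (f zero))
∑-select′ {suc k} (suc i) f = ∑-select′ i (f ∘ suc)

∑-scaleˡ : ∀ {k} c (f : Vector Bool k) → ∑[ j < k ] (c ∧ f j) ≡ c ∧ ∑[ j < k ] f j
∑-scaleˡ c f = sym (*-distribˡ-sum c f)

∑-scaleʳ : ∀ {k} c (f : Vector Bool k) → ∑[ j < k ] (f j ∧ c) ≡ (∑[ j < k ] f j) ∧ c
∑-scaleʳ c f = sym (*-distribʳ-sum c f)

∑≡true⇒∃ : ∀ {k} (f : Vector Bool k) → ∑[ i < k ] f i ≡ true → ∃[ i ] f i ≡ true
∑≡true⇒∃ {zero}  f ()
∑≡true⇒∃ {suc k} f s with f zero in eq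
... | true  = zero , eq
... | false with ∑≡true⇒∃ (f ∘ suc) s
...   | i , fi = suc i , fi

∑-δ : ∀ {k} (i : Fin k) → ∑[ j < k ] does (i ≟ j) ≡ true
∑-δ {k} i = trans (sum-cong-≗ λ j → sym (∧-identityʳ (does (i ≟ j)))) (∑-select i λ _ → true)

∑∑-select : ∀ {k m} v (F : Fin k → Fin m → Bool) → ∑[ u < k ] ∑[ w < m ] (does (v ≟ u) ∧ F u w) ≡ ∑[ w < m ] F v w
∑∑-select {m = m} v F = trans (sum-cong-≗ λ u → ∑-scaleˡ (does (v ≟ u)) (F u)) (∑-select v λ u → ∑[ w < m ] F u w)

∑-↑ : ∀ m n (f : Vector Bool (m + n)) →
      ∑[ i < m + n ] f i ≡ ∑[ i < m ] f (i ↑ˡ n) xor ∑[ i < n ] f (m ↑ʳ i)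
∑-↑ zero    n f = refl
∑-↑ (suc m) n f = trans (cong (f zero xor_) (∑-↑ m n (f ∘ suc))) (sym (xor-assoc (f zero) _ _))

∑-combine : ∀ m n (f : Vector Bool (m * n)) →
            ∑[ i < m * n ] f i ≡ ∑[ u < m ] ∑[ w < n ] f (combine u w)
∑-combine zero    n f = refl
∑-combine (suc m) n f =
  trans (∑-↑ n (m * n) f) (cong (∑[ w < n ] f (w ↑ˡ m * n) xor_) (∑-combine m n (λ i → f (n ↑ʳ i))))

flatten : ∀ {a b} {A : Set} → (Fin a → Fin b → A) → Fin (a * b) → A
flatten {b = b} f = uncurry f ∘ remQuot b

flatten-combine : ∀ {a b} {A : Set} (f : Fin a → Fin b → A) i j → flatten f (combine i j) ≡ f i j
flatten-combine f i j = cong (uncurry f) (remQuot-combine i j)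

-- The Fredholm alternative over 𝔽₂

infixl 7 _·_
_·_ : ∀ {k} → Vector Bool k → Vector Bool k → Bool
y · z = ∑[ e < _ ] (y e ∧ z e)

infixl 6 _⊕_
_⊕_ : ∀ {k} → Vector Bool k → Vector Bool k → Vector Bool k
(y ⊕ z) e = y e xor z e

·-distribʳ-⊕ : ∀ {k} (y z c : Vector Bool k) → (y ⊕ z) · c ≡ y · c xor z · c
·-distribʳ-⊕ y z c =
  trans (sum-cong-≗ (λ e → ∧-distribʳ-xor (c e) (y e) (z e))) (∑-distrib-+ (λ e → y e ∧ c e) (λ e → z e ∧ c e))

·-distribˡ-⊕ : ∀ {k} (y b c : Vector Bool k) → y · (b ⊕ c) ≡ y · b xor y · c
·-distribˡ-⊕ y b c =
  trans (sum-cong-≗ (λ e → ∧-distribˡ-xor (y e) (b e) (c e))) (∑-distrib-+ (λ e → y e ∧ b e) (λ e → y e ∧ c e))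

column : ∀ {k m} → (Fin k → Fin m → Bool) → Fin m → Vector Bool k
column M j e = M e j

Solvable : ∀ {k m} → (Fin k → Fin m → Bool) → Vector Bool k → Set
Solvable {m = m} M b = ∃ λ (x : Vector Bool m) → ∀ e → ∑[ j < m ] (M e j ∧ x j) ≡ b e

Refutable : ∀ {k m} → (Fin k → Fin m → Bool) → Vector Bool k → Set
Refutable {k} M b = ∃ λ (y : Vector Bool k) → (∀ j → y · column M j ≡ false) × y · b ≡ true

fredholm : ∀ {k m} (M : Fin k → Fin m → Bool) (b : Vector Bool k) → Solvable M b ⊎ Refutable M b
fredholm {m = zero} M b with any? (λ e → b e Data.Bool.≟ true)
... | yes (e , be) = inj₂ ((λ e′ → does (e ≟ e′)) , (λ ()) , trans (∑-select e b) be)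
... | no ¬be       = inj₁ ((λ ()) , λ e → sym (¬-not λ be → ¬be (e , be)))
fredholm {m = suc m} M b = extend (fredholm M′ b) (fredholm M′ (b ⊕ c))
  where
  M′ : _ → Fin m → Bool
  M′ e j = M e (suc j)
  c = column M zero

  rhs-shift : ∀ y → y · b ≡ y · (b ⊕ c) xor y · c
  rhs-shift y = sym (trans (cong (_xor y · c) (·-distribˡ-⊕ y b c)) (xor-cancelʳ (y · b) (y · c)))

  -- If y₁ refutes (M′, b) and y₂ refutes (M′, b ⊕ c), one of y₁, y₂, y₁ ⊕ y₂ is orthogonal to c.
  extend : Solvable M′ b ⊎ Refutable M′ b → Solvable M′ (b ⊕ c) ⊎ Refutable M′ (b ⊕ c) →
           Solvable M b ⊎ Refutable M b
  extend (inj₁ (x , sol)) _ = inj₁ (false Vector.∷ x , λ e → cong₂ _xor_ (∧-zeroʳ (c e)) (sol e))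
  extend (inj₂ _) (inj₁ (x , sol)) =
    inj₁ (true Vector.∷ x , λ e → trans (cong₂ _xor_ (∧-identityʳ (c e)) (sol e)) (xor-cancelˡ (c e) (b e)))
  extend (inj₂ (y₁ , orth₁ , r₁)) (inj₂ (y₂ , orth₂ , r₂)) with y₁ · c in c₁ | y₂ · c in c₂
  ... | false | _     = inj₂ (y₁ , (λ { zero → c₁ ; (suc j) → orth₁ j }) , r₁)
  ... | true  | false = inj₂ (y₂ , (λ { zero → c₂ ; (suc j) → orth₂ j }) ,
                              trans (rhs-shift y₂) (cong₂ _xor_ r₂ c₂))
  ... | true  | true  = inj₂ (y₁ ⊕ y₂ , orth , refutes)
    where
    orth : ∀ j → (y₁ ⊕ y₂) · column M j ≡ false
    orth zero    = trans (·-distribʳ-⊕ y₁ y₂ c) (cong₂ _xor_ c₁ c₂)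
    orth (suc j) = trans (·-distribʳ-⊕ y₁ y₂ (column M′ j)) (cong₂ _xor_ (orth₁ j) (orth₂ j))
    refutes : (y₁ ⊕ y₂) · b ≡ true
    refutes = trans (·-distribʳ-⊕ y₁ y₂ b) (cong₂ _xor_ r₁ (trans (rhs-shift y₂) (cong₂ _xor_ r₂ c₂)))

module _ {k₁ k₂ m₁ m₂ : ℕ} (M : Fin k₁ → Fin k₂ → Fin m₁ → Fin m₂ → Bool)
         (b : Fin k₁ → Fin k₂ → Bool) where

  Solvable² : Set
  Solvable² = ∃ λ (x : Fin m₁ → Fin m₂ → Bool) →
    ∀ e₁ e₂ → ∑[ j₁ < m₁ ] ∑[ j₂ < m₂ ] (M e₁ e₂ j₁ j₂ ∧ x j₁ j₂) ≡ b e₁ e₂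

  Refutable² : Set
  Refutable² = ∃ λ (y : Fin k₁ → Fin k₂ → Bool) →
    (∀ j₁ j₂ → ∑[ e₁ < k₁ ] ∑[ e₂ < k₂ ] (y e₁ e₂ ∧ M e₁ e₂ j₁ j₂) ≡ false) ×
    ∑[ e₁ < k₁ ] ∑[ e₂ < k₂ ] (y e₁ e₂ ∧ b e₁ e₂) ≡ true

  private
    M♭ : Fin (k₁ * k₂) → Fin (m₁ * m₂) → Bool
    M♭ e j = flatten (λ e₁ e₂ → flatten (M e₁ e₂) j) e

    M♭-combine : ∀ e₁ e₂ j₁ j₂ → M♭ (combine e₁ e₂) (combine j₁ j₂) ≡ M e₁ e₂ j₁ j₂
    M♭-combine e₁ e₂ j₁ j₂ = trans (flatten-combine (λ e₁ e₂ → flatten (M e₁ e₂) (combine j₁ j₂)) e₁ e₂)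
                                   (flatten-combine (M e₁ e₂) j₁ j₂)

    unflatten-solution : Solvable M♭ (flatten b) → Solvable²
    unflatten-solution (x , sol) = x ∘₂ combine , λ e₁ e₂ → begin
      ∑[ j₁ < m₁ ] ∑[ j₂ < m₂ ] (M e₁ e₂ j₁ j₂ ∧ x (combine j₁ j₂))
        ≡⟨ sum-cong-≗ (λ j₁ → sum-cong-≗ λ j₂ →
             cong (_∧ x (combine j₁ j₂)) (sym (M♭-combine e₁ e₂ j₁ j₂))) ⟩
      ∑[ j₁ < m₁ ] ∑[ j₂ < m₂ ] (M♭ (combine e₁ e₂) (combine j₁ j₂) ∧ x (combine j₁ j₂))
        ≡⟨ sym (∑-combine m₁ m₂ _) ⟩
      ∑[ j < m₁ * m₂ ] (M♭ (combine e₁ e₂) j ∧ x j)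
        ≡⟨ sol (combine e₁ e₂) ⟩
      flatten b (combine e₁ e₂)
        ≡⟨ flatten-combine b e₁ e₂ ⟩
      b e₁ e₂ ∎
      where open ≡-Reasoning

    unflatten-refutation : Refutable M♭ (flatten b) → Refutable²
    unflatten-refutation (y , orth , refutes) = y ∘₂ combine , orth² , trans (sym (∑y∧ (flatten b) b (flatten-combine b))) refutes
      where
      ∑y∧ : ∀ (g : Vector Bool (k₁ * k₂)) (h : Fin k₁ → Fin k₂ → Bool) →
            (∀ e₁ e₂ → g (combine e₁ e₂) ≡ h e₁ e₂) →
            y · g ≡ ∑[ e₁ < k₁ ] ∑[ e₂ < k₂ ] (y (combine e₁ e₂) ∧ h e₁ e₂)
      ∑y∧ g h gh = trans (∑-combine k₁ k₂ _)
                         (sum-cong-≗ λ e₁ → sum-cong-≗ λ e₂ → cong (y (combine e₁ e₂) ∧_) (gh e₁ e₂))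
      orth² : ∀ j₁ j₂ → ∑[ e₁ < k₁ ] ∑[ e₂ < k₂ ] (y (combine e₁ e₂) ∧ M e₁ e₂ j₁ j₂) ≡ false
      orth² j₁ j₂ = trans (sym (∑y∧ (column M♭ (combine j₁ j₂)) (λ e₁ e₂ → M e₁ e₂ j₁ j₂)
                                     λ e₁ e₂ → M♭-combine e₁ e₂ j₁ j₂))
                          (orth (combine j₁ j₂))

  fredholm² : Solvable² ⊎ Refutable²
  fredholm² = Data.Sum.map unflatten-solution unflatten-refutation (fredholm M♭ (flatten b))

-- Semi-cuts and the parity form of (WO)

data Cut : Set where
  empty positiveEven odd : Cut

cutOf : ℕ → Cut
cutOf zero    = empty
cutOf (suc d) = if oddᵇ d then positiveEven else odd

isOdd : Cut → Bool
isOdd odd = true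
isOdd _   = false

isOdd-cutOf : ∀ d → isOdd (cutOf d) ≡ oddᵇ d
isOdd-cutOf zero = refl
isOdd-cutOf (suc d) with oddᵇ d
... | true  = refl
... | false = refl

OddIn : Cut → Bool → Set
OddIn empty _ = ⊤
OddIn _     b = b ≡ true

-- (WO) at a vertex with semi-cut classes c⁺, c⁻ and first-colour parities o, i.  The choice
-- f = true is the second colour, whose parity in a semi-cut of class c is isOdd c xor o.
WOᵖ : Cut → Cut → Bool → Bool → Set
WOᵖ c⁺ c⁻ o i = ∃ λ f → OddIn c⁺ ((f ∧ isOdd c⁺) xor o) × OddIn c⁻ ((f ∧ isOdd c⁻) xor i)

flip-even-cut : ∀ f b → (f ∧ false) xor b ≡ b
flip-even-cut f b = cong (_xor b) (∧-zeroʳ f)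

flip-odd-cut : ∀ b → (not b ∧ true) xor b ≡ true
flip-odd-cut true  = refl
flip-odd-cut false = refl

WOᵖ-equal-cuts : ∀ {c⁺ c⁻ o i} → c⁺ ≡ c⁻ → c⁺ ≢ empty → WOᵖ c⁺ c⁻ o i → o ≡ i
WOᵖ-equal-cuts {empty}        refl ∅≢∅ _ = contradiction refl ∅≢∅
WOᵖ-equal-cuts {positiveEven} refl _ (false , refl , refl) = refl
WOᵖ-equal-cuts {positiveEven} refl _ (true  , refl , refl) = refl
WOᵖ-equal-cuts {odd}          refl _ (false , refl , refl) = refl
WOᵖ-equal-cuts {odd} {o = true}  {true}  refl _ (true , _ , _) = refl
WOᵖ-equal-cuts {odd} {o = false} {false} refl _ (true , _ , _) = refl
WOᵖ-equal-cuts {odd} {o = true}  {false} refl _ (true , () , _)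
WOᵖ-equal-cuts {odd} {o = false} {true}  refl _ (true , _ , ())

OddIn-positiveEven : ∀ {c} f b → c ≡ positiveEven → OddIn c ((f ∧ isOdd c) xor b) → b ≡ true
OddIn-positiveEven f b refl h = trans (sym (flip-even-cut f b)) h

cutOf-positive : ∀ {d} → 0 < d → cutOf d ≢ empty
cutOf-positive {suc d} _ with oddᵇ d
... | true  = λ ()
... | false = λ ()

cutOf-even : ∀ {d} → 0 < d → Even d → cutOf d ≡ positiveEven
cutOf-even {suc d} _ ev with oddᵇ d | even⇒oddᵇ≡false ev
... | true  | _  = refl
... | false | ()

cutOf-same-parity : ∀ {m n} → 0 < m → 0 < n → oddᵇ m ≡ oddᵇ n → cutOf m ≡ cutOf n
cutOf-same-parity {suc m} {suc n} _ _ eq with oddᵇ m | oddᵇ n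
... | true  | true  = refl
... | false | false = refl
... | true  | false = contradiction eq λ ()
... | false | true  = contradiction eq λ ()

cutOf≡positiveEven : ∀ d → cutOf d ≡ positiveEven → 0 < d × Even d
cutOf≡positiveEven zero    ()
cutOf≡positiveEven (suc d) eq with oddᵇ d in odd-d
... | true  = s≤s z≤n , oddᵇ≡false⇒even (suc d) (cong not odd-d)
... | false = contradiction eq λ ()

cutOf-same⇒even : ∀ m n → cutOf m ≡ cutOf n → Even (m + n)
cutOf-same⇒even m n eq = oddᵇ≡false⇒even (m + n) (begin
  oddᵇ (m + n)                          ≡⟨ oddᵇ-+ m n ⟩
  oddᵇ m xor oddᵇ n                     ≡⟨ cong₂ _xor_ (sym (isOdd-cutOf m)) (sym (isOdd-cutOf n)) ⟩
  isOdd (cutOf m) xor isOdd (cutOf n)   ≡⟨ cong (λ c → isOdd c xor isOdd (cutOf n)) eq ⟩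
  isOdd (cutOf n) xor isOdd (cutOf n)   ≡⟨ xor-same (isOdd (cutOf n)) ⟩
  false                                 ∎)
  where open ≡-Reasoning

positive⇒Odd⇔OddIn : ∀ d m → (0 < d → Odd m) ⇔ OddIn (cutOf d) (oddᵇ m)
positive⇒Odd⇔OddIn zero    m = mk⇔ (λ _ → tt) (λ _ ())
positive⇒Odd⇔OddIn (suc d) m with oddᵇ d
... | true  = mk⇔ (λ odd → from (odd (s≤s z≤n))) (λ o _ → to o) where open Equivalence (oddᵇ≡true⇔Odd m)
... | false = mk⇔ (λ odd → from (odd (s≤s z≤n))) (λ o _ → to o) where open Equivalence (oddᵇ≡true⇔Odd m)

data Equation : Set where
  none outOdd inOdd sameParity : Equation

onOut onIn rhs : Equation → Bool
onOut none       = false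
onOut outOdd     = true
onOut inOdd      = false
onOut sameParity = true
onIn  none       = false
onIn  outOdd     = false
onIn  inOdd      = true
onIn  sameParity = true
rhs   none       = false
rhs   outOdd     = true
rhs   inOdd      = true
rhs   sameParity = false

Holds : Equation → Bool → Bool → Set
Holds e o i = (onOut e ∧ o) xor (onIn e ∧ i) ≡ rhs e

-- (o, i) = (1, 1) satisfies every equation.
rhs-balanced : ∀ e → rhs e ≡ onOut e xor onIn e
rhs-balanced none       = refl
rhs-balanced outOdd     = refl
rhs-balanced inOdd      = refl
rhs-balanced sameParity = refl

outEquation : Cut → Cut → Equation
outEquation positiveEven _   = outOdd
outEquation odd          odd = sameParity
outEquation _            _   = none

inEquation : Cut → Equation
inEquation positiveEven = inOdd
inEquation _            = none

equations : Cut → Cut → Fin 2 → Equation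
equations c⁺ c⁻ zero       = outEquation c⁺ c⁻
equations c⁺ c⁻ (suc zero) = inEquation c⁻

equations⇒WOᵖ : ∀ c⁺ c⁻ o i → Holds (outEquation c⁺ c⁻) o i → Holds (inEquation c⁻) o i → WOᵖ c⁺ c⁻ o i
equations⇒WOᵖ empty        empty        o i _ _  = false , tt , tt
equations⇒WOᵖ empty        positiveEven o i _ h  = false , tt , h
equations⇒WOᵖ empty        odd          o i _ _  = not i , tt , flip-odd-cut i
equations⇒WOᵖ positiveEven empty        o i h _  = false , trans (sym (xor-identityʳ o)) h , tt
equations⇒WOᵖ positiveEven positiveEven o i h h′ = false , trans (sym (xor-identityʳ o)) h , h′
equations⇒WOᵖ positiveEven odd          o i h _  =
  not i , trans (flip-even-cut (not i) o) (trans (sym (xor-identityʳ o)) h) , flip-odd-cut i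
equations⇒WOᵖ odd          empty        o i _ _  = not o , flip-odd-cut o , tt
equations⇒WOᵖ odd          positiveEven o i _ h  = not o , flip-odd-cut o , trans (flip-even-cut (not o) i) h
equations⇒WOᵖ odd          odd false false _ _   = true  , refl , refl
equations⇒WOᵖ odd          odd true  true  _ _   = false , refl , refl
equations⇒WOᵖ odd          odd false true  () _
equations⇒WOᵖ odd          odd true  false () _

-- The possible combinations (α, β) of the coefficients of the equations at a vertex.
Admissible : Cut → Cut → Bool → Bool → Set
Admissible c⁺ c⁻ true  false = c⁺ ≡ positiveEven
Admissible c⁺ c⁻ false true  = c⁻ ≡ positiveEven
Admissible c⁺ c⁻ true  true  = c⁺ ≡ c⁻ × c⁺ ≢ empty
Admissible c⁺ c⁻ false false = ⊤

Admissible-swap : ∀ {c⁺ c⁻} a b → Admissible c⁺ c⁻ a b → Admissible c⁻ c⁺ b a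
Admissible-swap true  false adm = adm
Admissible-swap false true  adm = adm
Admissible-swap true  true  (c⁺≡c⁻ , c⁺≢∅) = sym c⁺≡c⁻ , λ c⁻≡∅ → c⁺≢∅ (trans c⁺≡c⁻ c⁻≡∅)
Admissible-swap false false adm = adm

Admissible-empty : ∀ a b → Admissible empty empty a b → a ≡ false × b ≡ false
Admissible-empty true  true  (_ , ∅≢∅) = contradiction refl ∅≢∅
Admissible-empty false false _ = refl , refl
Admissible-empty true  false ()
Admissible-empty false true  ()

labels-admissible : ∀ c⁺ c⁻ (y : Fin 2 → Bool) →
  Admissible c⁺ c⁻ (∑[ s < 2 ] (onOut (equations c⁺ c⁻ s) ∧ y s)) (∑[ s < 2 ] (onIn (equations c⁺ c⁻ s) ∧ y s))
labels-admissible empty        empty        y = tt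
labels-admissible empty        odd          y = tt
labels-admissible odd          empty        y = tt
labels-admissible empty        positiveEven y with y (suc zero)
... | true  = refl
... | false = tt
labels-admissible odd          positiveEven y with y (suc zero)
... | true  = refl
... | false = tt
labels-admissible positiveEven empty        y with y zero
... | true  = refl
... | false = tt
labels-admissible positiveEven odd          y with y zero
... | true  = refl
... | false = tt
labels-admissible positiveEven positiveEven y with y zero | y (suc zero)
... | true  | true  = refl , λ ()
... | true  | false = refl
... | false | true  = refl
... | false | false = tt
labels-admissible odd          odd          y with y zero
... | true  = refl , λ ()
... | false = tt

isSecond : Fin 2 → Bool
isSecond zero       = false
isSecond (suc zero) = true

module _ {k} (a : Fin k → Bool) (ψ : Fin k → Fin 2) where

  private
    d = countFin (λ w → T? (a w))
    o = ∑[ w < k ] (a w ∧ does (ψ w ≟ zero))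
    count : Fin 2 → ℕ
    count c = countFin (λ w → T? (a w) ×-dec (ψ w ≟ c))

  oddᵇ-colourCount : ∀ c → oddᵇ (count c) ≡ (isSecond c ∧ oddᵇ d) xor o
  oddᵇ-colourCount zero       = oddᵇ-countFin (λ w → T? (a w) ×-dec (ψ w ≟ zero))
  oddᵇ-colourCount (suc zero) = begin
    oddᵇ (count (suc zero))                                  ≡⟨ oddᵇ-countFin (λ w → T? (a w) ×-dec (ψ w ≟ suc zero)) ⟩
    ∑[ w < k ] (a w ∧ does (ψ w ≟ suc zero))                 ≡⟨ sum-cong-≗ (λ w → second-colour (a w) (ψ w)) ⟩
    ∑[ w < k ] (a w xor (a w ∧ does (ψ w ≟ zero)))           ≡⟨ ∑-distrib-+ a (λ w → a w ∧ does (ψ w ≟ zero)) ⟩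
    ∑[ w < k ] a w xor o                                     ≡⟨ cong (_xor o) (sym (oddᵇ-countFin (λ w → T? (a w)))) ⟩
    oddᵇ d xor o                                             ∎
    where
    open ≡-Reasoning
    second-colour : ∀ b c → b ∧ does (c ≟ suc zero) ≡ b xor (b ∧ does (c ≟ zero))
    second-colour false c          = refl
    second-colour true  zero       = refl
    second-colour true  (suc zero) = refl

  colourCondition⇔OddIn : ∀ c → (0 < d → Odd (count c)) ⇔ OddIn (cutOf d) ((isSecond c ∧ isOdd (cutOf d)) xor o)
  colourCondition⇔OddIn c = mk⇔ (subst (OddIn (cutOf d)) parity ∘ to) (from ∘ subst (OddIn (cutOf d)) (sym parity))
    where
    open Equivalence (positive⇒Odd⇔OddIn d (count c))
    parity : oddᵇ (count c) ≡ (isSecond c ∧ isOdd (cutOf d)) xor o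
    parity = trans (oddᵇ-colourCount c) (cong (λ b → (isSecond c ∧ b) xor o) (sym (isOdd-cutOf d)))

module _ (D : Digraph) where

  cut⁺ cut⁻ : Fin (n D) → Cut
  cut⁺ v = cutOf (outdeg D v)
  cut⁻ v = cutOf (indeg D v)

  firstColour : Colouring D → Fin (n D) → Fin (n D) → Bool
  firstColour φ u w = does (φ u w ≟ zero)

  colouring : (Fin (n D) → Fin (n D) → Bool) → Colouring D
  colouring x u w = if x u w then zero else suc zero

  outParity inParity : (Fin (n D) → Fin (n D) → Bool) → Fin (n D) → Bool
  outParity x v = ∑[ w < n D ] (arc D v w ∧ x v w)
  inParity  x v = ∑[ u < n D ] (arc D u v ∧ x u v)

  WO⇔WOᵖ : ∀ φ v → WO D φ v ⇔ WOᵖ (cut⁺ v) (cut⁻ v) (outParity (firstColour φ) v) (inParity (firstColour φ) v)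
  WO⇔WOᵖ φ v = mk⇔ to from
    where
    out = colourCondition⇔OddIn (arc D v) (φ v)
    in′ = colourCondition⇔OddIn (λ u → arc D u v) (λ u → φ u v)
    to : WO D φ v → WOᵖ _ _ _ _
    to (c , h⁺ , h⁻) = isSecond c , Equivalence.to (out c) h⁺ , Equivalence.to (in′ c) h⁻
    from : WOᵖ _ _ _ _ → WO D φ v
    from (false , o⁺ , o⁻) = zero , Equivalence.from (out zero) o⁺ , Equivalence.from (in′ zero) o⁻
    from (true  , o⁺ , o⁻) = suc zero , Equivalence.from (out (suc zero)) o⁺ , Equivalence.from (in′ (suc zero)) o⁻

  firstColour-colouring : ∀ x u w → firstColour (colouring x) u w ≡ x u w
  firstColour-colouring x u w with x u w
  ... | true  = refl
  ... | false = refl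

-- The lower bound

another-vertex : ∀ {k} → 2 ≤ k → (p : Fin k) → ∃ λ w → w ≢ p
another-vertex (s≤s (s≤s z≤n)) zero    = suc zero , λ ()
another-vertex (s≤s (s≤s z≤n)) (suc p) = zero , λ ()

distinct⇒2≤ : ∀ {k} (a b : Fin k) → a ≢ b → 2 ≤ k
distinct⇒2≤ {zero}       ()
distinct⇒2≤ {suc zero}    zero zero a≢b = contradiction refl a≢b
distinct⇒2≤ {suc (suc k)} _    _    _   = s≤s (s≤s z≤n)

module _ (D : Digraph) where

  outParity-isolated : ∀ x v → outdeg D v ≡ 0 → outParity D x v ≡ false
  outParity-isolated x v d≡0 =
    trans (sum-cong-≗ λ w → cong (_∧ x v w) (¬T⇒≡false (countFin≡0⇒¬ (λ w → T? (arc D v w)) d≡0 w)))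
          (sum-replicate-zero (n D))

  inParity-isolated : ∀ x v → indeg D v ≡ 0 → inParity D x v ≡ false
  inParity-isolated x v d≡0 =
    trans (sum-cong-≗ λ u → cong (_∧ x u v) (¬T⇒≡false (countFin≡0⇒¬ (λ u → T? (arc D u v)) d≡0 u)))
          (sum-replicate-zero (n D))

  handshake : ∀ x → ∑[ v < n D ] outParity D x v ≡ ∑[ v < n D ] inParity D x v
  handshake x = ∑-comm (λ v w → arc D v w ∧ x v w)

  nonperipheral-cuts : EvenDigraph D → ∀ v → ¬ Peripheral D v → cut⁺ D v ≡ cut⁻ D v × cut⁺ D v ≢ empty
  nonperipheral-cuts even v ¬per =
    cutOf-same-parity out>0 in>0 (xor≡false⇒≡ _ _ (trans (sym (oddᵇ-+ (outdeg D v) (indeg D v))) (even⇒oddᵇ≡false (even v)))) ,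
    cutOf-positive out>0
    where
    out>0 = n≢0⇒n>0 (¬per ∘ inj₁)
    in>0  = n≢0⇒n>0 (¬per ∘ inj₂)

  peripheral-cuts : Semicomplete D → Nontrivial D → EvenDigraph D → ∀ p → Peripheral D p →
                    (outdeg D p ≡ 0 × cut⁻ D p ≡ positiveEven) ⊎ (indeg D p ≡ 0 × cut⁺ D p ≡ positiveEven)
  peripheral-cuts sc nontrivial even p (inj₁ out≡0) =
    inj₁ (out≡0 , cutOf-even in>0 (subst (λ d → Even (d + indeg D p)) out≡0 (even p)))
    where
    w = proj₁ (another-vertex nontrivial p)
    in>0 : 0 < indeg D p
    in>0 with sc w p (proj₂ (another-vertex nontrivial p))
    ... | inj₁ w→p = countFin-positive (λ u → T? (arc D u p)) w w→p
    ... | inj₂ p→w = contradiction p→w (countFin≡0⇒¬ (λ w → T? (arc D p w)) out≡0 w)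
  peripheral-cuts sc nontrivial even p (inj₂ in≡0) =
    inj₂ (in≡0 , cutOf-even out>0 (subst Even (+-identityʳ (outdeg D p))
                                    (subst (λ d → Even (outdeg D p + d)) in≡0 (even p))))
    where
    w = proj₁ (another-vertex nontrivial p)
    out>0 : 0 < outdeg D p
    out>0 with sc p w (λ p≡w → proj₂ (another-vertex nontrivial p) (sym p≡w))
    ... | inj₁ p→w = countFin-positive (λ w → T? (arc D p w)) w p→w
    ... | inj₂ w→p = contradiction w→p (countFin≡0⇒¬ (λ u → T? (arc D u p)) in≡0 w)

  not-WO-everywhere : Semicomplete D → SpecialCase D → ∀ φ → ¬ (∀ v → WO D φ v)
  not-WO-everywhere sc (nontrivial , even , p , peripheral , unique) φ wo =
    contradiction (trans (sym imbalance) balance) λ ()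
    where
    x = firstColour D φ
    o = outParity D x
    i = inParity D x
    woᵖ : ∀ v → WOᵖ (cut⁺ D v) (cut⁻ D v) (o v) (i v)
    woᵖ v = Equivalence.to (WO⇔WOᵖ D φ v) (wo v)
    at-p : o p xor i p ≡ true
    at-p with peripheral-cuts sc nontrivial even p peripheral | woᵖ p
    ... | inj₁ (out≡0 , cut⁻≡pe) | (f , _ , in-odd) =
          cong₂ _xor_ (outParity-isolated x p out≡0) (OddIn-positiveEven f (i p) cut⁻≡pe in-odd)
    ... | inj₂ (in≡0 , cut⁺≡pe)  | (f , out-odd , _) =
          cong₂ _xor_ (OddIn-positiveEven f (o p) cut⁺≡pe out-odd) (inParity-isolated x p in≡0)
    pointwise : ∀ v → o v xor i v ≡ does (p ≟ v)
    pointwise v with p ≟ v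
    ... | yes refl = at-p
    ... | no p≢v   = let (same , nonempty) = nonperipheral-cuts even v (λ per → p≢v (sym (unique v per))) in
                     trans (cong (_xor i v) (WOᵖ-equal-cuts same nonempty (woᵖ v))) (xor-same (i v))
    imbalance : ∑[ v < n D ] (o v xor i v) ≡ true
    imbalance = trans (sum-cong-≗ pointwise) (∑-δ p)
    balance : ∑[ v < n D ] (o v xor i v) ≡ false
    balance = trans (∑-distrib-+ o i) (trans (cong (_xor ∑[ v < n D ] i v) (handshake x)) (xor-same (∑[ v < n D ] i v)))

-- The linear system of a digraph

-- The vertex labels carried by a refutation of the equations with semi-cut classes κ⁺, κ⁻.
record Obstruction (D : Digraph) (κ⁺ κ⁻ : Fin (n D) → Cut) : Set where
  field
    α β            : Fin (n D) → Bool
    arc-compatible : ∀ u w → T (arc D u w) → α u ≡ β w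
    admissible     : ∀ v → Admissible (κ⁺ v) (κ⁻ v) (α v) (β v)
    imbalanced     : ∑[ v < n D ] (α v xor β v) ≡ true

module VertexSystem (D : Digraph) (κ⁺ κ⁻ : Fin (n D) → Cut) where

  private
    N = n D
    A = arc D

  equation : Fin N → Fin 2 → Equation
  equation v = equations (κ⁺ v) (κ⁻ v)

  -- Unknown (u, w) says that uw has the first colour; equation (v, s) is the s-th equation at v.
  coefficient : Fin N → Fin 2 → Fin N → Fin N → Bool
  coefficient v s u w = (does (v ≟ u) ∧ (onOut (equation v s) ∧ A u w)) xor (does (v ≟ w) ∧ (onIn (equation v s) ∧ A u w))

  target : Fin N → Fin 2 → Bool
  target v s = rhs (equation v s)

  outLabel inLabel : (Fin N → Fin 2 → Bool) → Fin N → Bool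
  outLabel y v = ∑[ s < 2 ] (onOut (equation v s) ∧ y v s)
  inLabel  y v = ∑[ s < 2 ] (onIn  (equation v s) ∧ y v s)

  row-sum : ∀ x v s → let e = equation v s in
            ∑[ u < N ] ∑[ w < N ] (coefficient v s u w ∧ x u w) ≡ (onOut e ∧ outParity D x v) xor (onIn e ∧ inParity D x v)
  row-sum x v s = begin
    ∑[ u < N ] ∑[ w < N ] (coefficient v s u w ∧ x u w)
      ≡⟨ sum-cong-≗ (λ u → trans (sum-cong-≗ λ w → split u w) (∑-distrib-+ (out u) (in′ u))) ⟩
    ∑[ u < N ] (∑[ w < N ] out u w xor ∑[ w < N ] in′ u w)
      ≡⟨ ∑-distrib-+ (λ u → ∑[ w < N ] out u w) (λ u → ∑[ w < N ] in′ u w) ⟩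
    ∑[ u < N ] ∑[ w < N ] out u w xor ∑[ u < N ] ∑[ w < N ] in′ u w
      ≡⟨ cong₂ _xor_ (trans (∑∑-select v λ u w → a ∧ X u w) (∑-scaleˡ a (X v)))
                     (trans (∑-comm in′) (trans (∑∑-select v λ w u → b ∧ X u w) (∑-scaleˡ b λ u → X u v))) ⟩
    (a ∧ outParity D x v) xor (b ∧ inParity D x v) ∎
    where
    open ≡-Reasoning
    a = onOut (equation v s)
    b = onIn (equation v s)
    X : Fin N → Fin N → Bool
    X u w = A u w ∧ x u w
    out in′ : Fin N → Fin N → Bool
    out u w = does (v ≟ u) ∧ (a ∧ X u w)
    in′ u w = does (v ≟ w) ∧ (b ∧ X u w)
    split : ∀ u w → coefficient v s u w ∧ x u w ≡ out u w xor in′ u w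
    split u w = trans (∧-distribʳ-xor (x u w) (does (v ≟ u) ∧ (a ∧ A u w)) (does (v ≟ w) ∧ (b ∧ A u w)))
                      (cong₂ _xor_ (reassoc (does (v ≟ u)) a) (reassoc (does (v ≟ w)) b))
      where
      reassoc : ∀ d c → (d ∧ (c ∧ A u w)) ∧ x u w ≡ d ∧ (c ∧ X u w)
      reassoc d c = trans (∧-assoc d (c ∧ A u w) (x u w)) (cong (d ∧_) (∧-assoc c (A u w) (x u w)))

  column-sum : ∀ y u w → ∑[ v < N ] ∑[ s < 2 ] (y v s ∧ coefficient v s u w) ≡
               (outLabel y u ∧ A u w) xor (inLabel y w ∧ A u w)
  column-sum y u w = begin
    ∑[ v < N ] ∑[ s < 2 ] (y v s ∧ coefficient v s u w)
      ≡⟨ sum-cong-≗ (λ v → trans (sum-cong-≗ (split v)) (∑-distrib-+ (out v) (in′ v))) ⟩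
    ∑[ v < N ] (∑[ s < 2 ] out v s xor ∑[ s < 2 ] in′ v s)
      ≡⟨ sum-cong-≗ (λ v → cong₂ _xor_ (collect v (does (v ≟ u)) onOut) (collect v (does (v ≟ w)) onIn)) ⟩
    ∑[ v < N ] ((does (v ≟ u) ∧ (outLabel y v ∧ A u w)) xor (does (v ≟ w) ∧ (inLabel y v ∧ A u w)))
      ≡⟨ ∑-distrib-+ (λ v → does (v ≟ u) ∧ (outLabel y v ∧ A u w)) (λ v → does (v ≟ w) ∧ (inLabel y v ∧ A u w)) ⟩
    ∑[ v < N ] (does (v ≟ u) ∧ (outLabel y v ∧ A u w)) xor ∑[ v < N ] (does (v ≟ w) ∧ (inLabel y v ∧ A u w))
      ≡⟨ cong₂ _xor_ (∑-select′ u λ v → outLabel y v ∧ A u w) (∑-select′ w λ v → inLabel y v ∧ A u w) ⟩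
    (outLabel y u ∧ A u w) xor (inLabel y w ∧ A u w) ∎
    where
    open ≡-Reasoning
    out in′ : Fin N → Fin 2 → Bool
    out v s = does (v ≟ u) ∧ ((onOut (equation v s) ∧ y v s) ∧ A u w)
    in′ v s = does (v ≟ w) ∧ ((onIn (equation v s) ∧ y v s) ∧ A u w)
    shuffle : ∀ t d c → t ∧ (d ∧ (c ∧ A u w)) ≡ d ∧ ((c ∧ t) ∧ A u w)
    shuffle false d false = sym (∧-zeroʳ d)
    shuffle false d true  = sym (∧-zeroʳ d)
    shuffle true  d false = refl
    shuffle true  d true  = refl
    split : ∀ v s → y v s ∧ coefficient v s u w ≡ out v s xor in′ v s
    split v s = trans (∧-distribˡ-xor (y v s) (does (v ≟ u) ∧ (onOut (equation v s) ∧ A u w))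
                                                (does (v ≟ w) ∧ (onIn (equation v s) ∧ A u w)))
                      (cong₂ _xor_ (shuffle (y v s) (does (v ≟ u)) (onOut (equation v s)))
                                   (shuffle (y v s) (does (v ≟ w)) (onIn (equation v s))))
    collect : ∀ v d (coeff : Equation → Bool) →
              ∑[ s < 2 ] (d ∧ ((coeff (equation v s) ∧ y v s) ∧ A u w)) ≡
              d ∧ (∑[ s < 2 ] (coeff (equation v s) ∧ y v s) ∧ A u w)
    collect v d coeff = trans (∑-scaleˡ d (λ s → (coeff (equation v s) ∧ y v s) ∧ A u w))
                              (cong (d ∧_) (∑-scaleʳ (A u w) (λ s → coeff (equation v s) ∧ y v s)))

  alternative : (∃ λ x → ∀ v → WOᵖ (κ⁺ v) (κ⁻ v) (outParity D x v) (inParity D x v)) ⊎ Obstruction D κ⁺ κ⁻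
  alternative with fredholm² coefficient target
  ... | inj₁ (x , solves) = inj₁ (x , λ v → equations⇒WOᵖ (κ⁺ v) (κ⁻ v) _ _ (holds v zero) (holds v (suc zero)))
    where
    holds : ∀ v s → Holds (equation v s) (outParity D x v) (inParity D x v)
    holds v s = trans (sym (row-sum x v s)) (solves v s)
  ... | inj₂ (y , orthogonal , refutes) = inj₂ record
    { α              = outLabel y
    ; β              = inLabel y
    ; arc-compatible = λ u w u→w → cancel-arc (outLabel y u) (inLabel y w) u→w (trans (sym (column-sum y u w)) (orthogonal u w))
    ; admissible     = λ v → labels-admissible (κ⁺ v) (κ⁻ v) (y v)
    ; imbalanced     = trans (sym (sum-cong-≗ λ v → trans (sum-cong-≗ (balance v))
                                                          (∑-distrib-+ (outTerm v) (inTerm v)))) refutes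
    }
    where
    cancel-arc : ∀ a b {c} → T c → (a ∧ c) xor (b ∧ c) ≡ false → a ≡ b
    cancel-arc a b {false} ()
    cancel-arc a b {true} _ h = xor≡false⇒≡ a b (trans (cong₂ _xor_ (sym (∧-identityʳ a)) (sym (∧-identityʳ b))) h)
    outTerm inTerm : Fin N → Fin 2 → Bool
    outTerm v s = onOut (equation v s) ∧ y v s
    inTerm  v s = onIn (equation v s) ∧ y v s
    balance : ∀ v s → y v s ∧ target v s ≡ outTerm v s xor inTerm v s
    balance v s = trans (cong (y v s ∧_) (rhs-balanced (equation v s)))
                        (trans (∧-distribˡ-xor (y v s) (onOut (equation v s)) (onIn (equation v s)))
                               (cong₂ _xor_ (∧-comm (y v s) _) (∧-comm (y v s) _)))

-- Obstructions in semicomplete digraphs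

module SourceObstruction (D : Digraph) (sc : Semicomplete D) (O : Obstruction D (cut⁺ D) (cut⁻ D))
                         (q : Fin (n D)) (αq : Obstruction.α O q ≡ true) (βq : Obstruction.β O q ≡ false) where

  open Obstruction O

  private
    admissible-at : ∀ v {a b} → α v ≡ a → β v ≡ b → Admissible (cut⁺ D v) (cut⁻ D v) a b
    admissible-at v refl refl = admissible v

    true≢false : true ≢ false
    true≢false ()

  q-out : 0 < outdeg D q × Even (outdeg D q)
  q-out = cutOf≡positiveEven (outdeg D q) (admissible-at q αq βq)

  w₀ : Fin (n D)
  w₀ = proj₁ (countFin-witness (λ w → T? (arc D q w)) (proj₁ q-out))

  q→w₀ : T (arc D q w₀)
  q→w₀ = proj₂ (countFin-witness (λ w → T? (arc D q w)) (proj₁ q-out))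

  βw₀ : β w₀ ≡ true
  βw₀ = trans (sym (arc-compatible q w₀ q→w₀)) αq

  w₀≢q : w₀ ≢ q
  w₀≢q w₀≡q = subst T (loopless D q) (subst (λ w → T (arc D q w)) w₀≡q q→w₀)

  no-other-source : ∀ w → w ≢ q → α w ≡ true → β w ≡ false → ⊥
  no-other-source w w≢q αw βw with sc q w (w≢q ∘ sym)
  ... | inj₁ q→w = true≢false (trans (sym αq) (trans (arc-compatible q w q→w) βw))
  ... | inj₂ w→q = true≢false (trans (sym αw) (trans (arc-compatible w q w→q) βq))

  no-two-sinks : ∀ w z → w ≢ z → α w ≡ false → β w ≡ true → α z ≡ false → β z ≡ true → ⊥
  no-two-sinks w z w≢z αw βw αz βz with sc w z w≢z
  ... | inj₁ w→z = true≢false (trans (sym βz) (trans (sym (arc-compatible w z w→z)) αw))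
  ... | inj₂ z→w = true≢false (trans (sym βw) (trans (sym (arc-compatible z w z→w)) αz))

  -- A vertex w ≢ q with α w = 0 and β w = 1 would leave exactly two unbalanced vertices.
  balanced : ∀ w → w ≢ q → α w ≡ β w
  balanced w w≢q with α w in αw | β w in βw
  ... | true  | true  = refl
  ... | false | false = refl
  ... | true  | false = ⊥-elim (no-other-source w w≢q αw βw)
  ... | false | true  = ⊥-elim (true≢false (trans (sym imbalanced) two-unbalanced))
    where
    balanced-elsewhere : ∀ z → z ≢ q → w ≢ z → α z ≡ β z
    balanced-elsewhere z z≢q w≢z with α z in αz | β z in βz
    ... | true  | true  = refl
    ... | false | false = refl
    ... | true  | false = ⊥-elim (no-other-source z z≢q αz βz)
    ... | false | true  = ⊥-elim (no-two-sinks w z w≢z αw βw αz βz)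
    pointwise : ∀ z → α z xor β z ≡ does (q ≟ z) xor does (w ≟ z)
    pointwise z with q ≟ z | w ≟ z
    ... | yes q≡z | yes w≡z = ⊥-elim (w≢q (trans w≡z (sym q≡z)))
    ... | yes q≡z | no _    = subst (λ z → α z xor β z ≡ true) q≡z (cong₂ _xor_ αq βq)
    ... | no _    | yes w≡z = subst (λ z → α z xor β z ≡ true) w≡z (cong₂ _xor_ αw βw)
    ... | no q≢z  | no w≢z  = trans (cong (_xor β z) (balanced-elsewhere z (q≢z ∘ sym) w≢z)) (xor-same (β z))
    two-unbalanced : ∑[ z < n D ] (α z xor β z) ≡ false
    two-unbalanced = trans (sum-cong-≗ pointwise)
                           (trans (∑-distrib-+ (λ z → does (q ≟ z)) (λ z → does (w ≟ z))) (cong₂ _xor_ (∑-δ q) (∑-δ w)))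

  all-α : ∀ w → α w ≡ true
  all-α w with w ≟ q
  ... | yes refl = αq
  ... | no w≢q with α w in αw
  ...   | true  = refl
  ...   | false = ⊥-elim (true≢false (arc-between (sc w w₀ w≢w₀)))
    where
    βw : β w ≡ false
    βw = trans (sym (balanced w w≢q)) αw
    w≢w₀ : w ≢ w₀
    w≢w₀ w≡w₀ = true≢false (trans (sym βw₀) (trans (cong β (sym w≡w₀)) βw))
    arc-between : T (arc D w w₀) ⊎ T (arc D w₀ w) → true ≡ false
    arc-between (inj₁ w→w₀) = trans (sym βw₀) (trans (sym (arc-compatible w w₀ w→w₀)) αw)
    arc-between (inj₂ w₀→w) = trans (sym (trans (balanced w₀ w₀≢q) βw₀)) (trans (arc-compatible w₀ w w₀→w) βw)

  β-elsewhere : ∀ w → w ≢ q → β w ≡ true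
  β-elsewhere w w≢q = trans (sym (balanced w w≢q)) (all-α w)

  indeg-q : indeg D q ≡ 0
  indeg-q = countFin-none (λ u → T? (arc D u q))
              λ u u→q → true≢false (trans (sym (all-α u)) (trans (arc-compatible u q u→q) βq))

  cuts-elsewhere : ∀ w → w ≢ q → cut⁺ D w ≡ cut⁻ D w × cut⁺ D w ≢ empty
  cuts-elsewhere w w≢q = admissible-at w (all-α w) (β-elsewhere w w≢q)

  special : SpecialCase D
  special = distinct⇒2≤ w₀ q w₀≢q , even , q , inj₂ indeg-q , only-q
    where
    even : EvenDigraph D
    even v with v ≟ q
    ... | yes refl = subst (λ d → Even (outdeg D q + d)) (sym indeg-q)
                           (subst Even (sym (+-identityʳ (outdeg D q))) (proj₂ q-out))
    ... | no v≢q   = cutOf-same⇒even (outdeg D v) (indeg D v) (proj₁ (cuts-elsewhere v v≢q))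
    only-q : ∀ w → Peripheral D w → w ≡ q
    only-q w peripheral with w ≟ q
    ... | yes w≡q = w≡q
    ... | no w≢q with cuts-elsewhere w w≢q | peripheral
    ...   | (_      , nonempty) | inj₁ out≡0 = ⊥-elim (nonempty (cong cutOf out≡0))
    ...   | (same , nonempty)   | inj₂ in≡0  = ⊥-elim (nonempty (trans same (cong cutOf in≡0)))

reverse : Digraph → Digraph
reverse D = record { n = n D ; arc = λ u w → arc D w u ; loopless = loopless D }

module _ (D : Digraph) where

  reverse-semicomplete : Semicomplete D → Semicomplete (reverse D)
  reverse-semicomplete sc u v u≢v = Data.Sum.swap (sc u v u≢v)

  reverse-obstruction : Obstruction D (cut⁺ D) (cut⁻ D) → Obstruction (reverse D) (cut⁺ (reverse D)) (cut⁻ (reverse D))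
  reverse-obstruction O = record
    { α              = β
    ; β              = α
    ; arc-compatible = λ u w w→u → sym (arc-compatible w u w→u)
    ; admissible     = λ v → Admissible-swap (α v) (β v) (admissible v)
    ; imbalanced     = trans (sum-cong-≗ λ v → xor-comm (β v) (α v)) imbalanced
    }
    where open Obstruction O

  special-reverse : SpecialCase (reverse D) → SpecialCase D
  special-reverse (nontrivial , even , p , peripheral , only-p) =
    nontrivial , (λ v → subst Even (+-comm (indeg D v) (outdeg D v)) (even v)) ,
    p , Data.Sum.swap peripheral , λ w → only-p w ∘ Data.Sum.swap

  obstruction⇒special : Semicomplete D → (O : Obstruction D (cut⁺ D) (cut⁻ D)) → let open Obstruction O in
                        SpecialCase D × ((∀ v → α v ≡ true) ⊎ (∀ v → β v ≡ true))
  obstruction⇒special sc O = orient (∑≡true⇒∃ (λ v → α v xor β v) imbalanced)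
    where
    open Obstruction O
    orient : ∃ (λ q → α q xor β q ≡ true) → SpecialCase D × ((∀ v → α v ≡ true) ⊎ (∀ v → β v ≡ true))
    orient (q , unbalanced) with α q in αq | β q in βq
    ... | true  | false = special , inj₁ all-α
      where open SourceObstruction D sc O q αq βq
    ... | false | true  = special-reverse special , inj₂ all-α
      where open SourceObstruction (reverse D) (reverse-semicomplete sc) (reverse-obstruction O) q βq αq
    ... | true  | true  = contradiction unbalanced λ ()
    ... | false | false = contradiction unbalanced λ ()

module _ (D : Digraph) (φ : Colouring D) where

  failures≡0 : (∀ v → WO D φ v) → failures D φ ≡ 0
  failures≡0 wo = countFin-none (λ v → ¬? (WO? D φ v)) λ v ¬wo → ¬wo (wo v)

  failures≤1 : ∀ p → (∀ v → v ≢ p → WO D φ v) → failures D φ ≤ 1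
  failures≤1 p wo = countFin≤1 (λ v → ¬? (WO? D φ v)) p only-p
    where
    only-p : ∀ v → ¬ WO D φ v → v ≡ p
    only-p v ¬wo with v ≟ p
    ... | yes v≡p = v≡p
    ... | no v≢p  = contradiction (wo v v≢p) ¬wo

  failures≥1 : ¬ (∀ v → WO D φ v) → 1 ≤ failures D φ
  failures≥1 ¬wo with any? (λ v → ¬? (WO? D φ v))
  ... | yes (v , ¬wo-v) = countFin-positive (λ v → ¬? (WO? D φ v)) v ¬wo-v
  ... | no  ¬∃          = contradiction (λ v → decidable-stable (WO? D φ v) λ ¬wo-v → ¬∃ (v , ¬wo-v)) ¬wo

module _ (D : Digraph) where

  colouring-WO : ∀ x v → WOᵖ (cut⁺ D v) (cut⁻ D v) (outParity D x v) (inParity D x v) → WO D (colouring D x) v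
  colouring-WO x v woᵖ = Equivalence.from (WO⇔WOᵖ D (colouring D x) v)
    (subst₂ (WOᵖ (cut⁺ D v) (cut⁻ D v))
            (sum-cong-≗ λ w → cong (arc D v w ∧_) (sym (firstColour-colouring D x v w)))
            (sum-cong-≗ λ u → cong (arc D u v ∧_) (sym (firstColour-colouring D x u v))) woᵖ)

  -- Giving p the semi-cut classes of an isolated vertex removes its equations.
  relaxAt : Fin (n D) → (Fin (n D) → Cut) → Fin (n D) → Cut
  relaxAt p κ v = if does (p ≟ v) then empty else κ v

  relaxAt-elsewhere : ∀ p κ v → p ≢ v → relaxAt p κ v ≡ κ v
  relaxAt-elsewhere p κ v p≢v = cong (if_then empty else κ v) (dec-false (p ≟ v) p≢v)

  relaxAt-here : ∀ p κ → relaxAt p κ p ≡ empty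
  relaxAt-here p κ = cong (if_then empty else κ p) (dec-true (p ≟ p) refl)

  module _ (p : Fin (n D)) {κ⁺ κ⁻ : Fin (n D) → Cut} (O : Obstruction D (relaxAt p κ⁺) (relaxAt p κ⁻)) where
    open Obstruction O

    relaxed-vertex-unlabelled : α p ≡ false × β p ≡ false
    relaxed-vertex-unlabelled =
      Admissible-empty (α p) (β p) (subst₂ (λ c⁺ c⁻ → Admissible c⁺ c⁻ (α p) (β p))
                                           (relaxAt-here p κ⁺) (relaxAt-here p κ⁻) (admissible p))

    unrelax : Obstruction D κ⁺ κ⁻
    unrelax = record { α = α ; β = β ; arc-compatible = arc-compatible ; admissible = admissible′ ; imbalanced = imbalanced }
      where
      admissible′ : ∀ v → Admissible (κ⁺ v) (κ⁻ v) (α v) (β v)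
      admissible′ v with p ≟ v
      ... | yes refl = subst₂ (Admissible (κ⁺ p) (κ⁻ p)) (sym (proj₁ relaxed-vertex-unlabelled))
                                                         (sym (proj₂ relaxed-vertex-unlabelled)) tt
      ... | no p≢v   = subst₂ (λ c⁺ c⁻ → Admissible c⁺ c⁻ (α v) (β v))
                              (relaxAt-elsewhere p κ⁺ v p≢v) (relaxAt-elsewhere p κ⁻ v p≢v) (admissible v)

module _ (D : Digraph) (sc : Semicomplete D) where

  defect-zero : ¬ SpecialCase D → IsDefect D 0
  defect-zero ¬special with VertexSystem.alternative D (cut⁺ D) (cut⁻ D)
  ... | inj₁ (x , woᵖ) = (colouring D x , failures≡0 D (colouring D x) λ v → colouring-WO D x v (woᵖ v)) , λ _ → z≤n
  ... | inj₂ O         = contradiction (proj₁ (obstruction⇒special D sc O)) ¬special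

  defect-one : SpecialCase D → IsDefect D 1
  defect-one special@(_ , _ , p , _) = optimal , λ φ → failures≥1 D φ (not-WO-everywhere D sc special φ)
    where
    optimal : ∃ λ φ → failures D φ ≡ 1
    optimal with VertexSystem.alternative D (relaxAt D p (cut⁺ D)) (relaxAt D p (cut⁻ D))
    ... | inj₁ (x , woᵖ) = colouring D x , ≤-antisym (failures≤1 D (colouring D x) p wo-elsewhere)
                                                     (failures≥1 D (colouring D x) (not-WO-everywhere D sc special _))
      where
      wo-elsewhere : ∀ v → v ≢ p → WO D (colouring D x) v
      wo-elsewhere v v≢p = colouring-WO D x v (subst₂ (λ c⁺ c⁻ → WOᵖ c⁺ c⁻ (outParity D x v) (inParity D x v))
                                                      (relaxAt-elsewhere D p (cut⁺ D) v (v≢p ∘ sym))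
                                                      (relaxAt-elsewhere D p (cut⁻ D) v (v≢p ∘ sym)) (woᵖ v))
    ... | inj₂ O with proj₂ (obstruction⇒special D sc (unrelax D p O)) | relaxed-vertex-unlabelled D p O
    ...   | inj₁ all-α | αp , _ = contradiction (trans (sym (all-α p)) αp) λ ()
    ...   | inj₂ all-β | _ , βp = contradiction (trans (sym (all-β p)) βp) λ ()

proposition3p2 : (D : Digraph) → Semicomplete D →
    (SpecialCase D → IsDefect D 1) × (¬ SpecialCase D → IsDefect D 0)
proposition3p2 D sc = defect-one D sc , defect-zero D sc
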